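{- For $k=2$ and a correct translation $\tau$ of blocking type $(P_1, P_2)$, the initial store can only be $(\blacksquare,\blacksquare)$ and the prefixes of $\tau(!)$ and $\tau(?)$ are $\{P_2,T_2\}^*P_1$, and $\{P_1,T_1\}^*P_2$.
   Context: SYNCSIMPLE: subprocesses $U ::= \checkmark \mid 0 \mid\ !U \mid\ ?U$; processes are parallel compositions (multisets) of subprocesses; reduction $!U_1 \mid ?U_2 \mid P \to U_1 \mid U_2 \mid P$; successful = has a parallel component $\checkmark$; may-convergent = reduces to a successful process; must-convergent = every reduct is may-convergent. LOCKSIMPLE$_{2,IS}$: two locks, each full ($\blacksquare$) or empty ($\Box$), initial store $IS$; subprocesses $U ::= 0 \mid \checkmark \mid P_iU \mid T_iU$ ($i\in\{1,2\}$); $P_i$ on empty lock $i$ fills it, on a full lock blocks; $T_i$ never blocks and empties lock $i$. Convergence evaluated from $(P,IS)$. $\tau$: SYNCSIMPLE $\to$ LOCKSIMPLE$_{2,IS}$ is compositional ($\tau(0)=0$, $\tau(\checkmark)=\checkmark$, $\tau$ commutes with parallel composition, $\tau(!U)=\tau(!)\tau(U)$, $\tau(?U)=\tau(?)\tau(U)$); correct = preserve and reflect may- and must-convergence. Blocking type $P_i$ of a sequence $S$ executed alone from $IS$: $S$ has a prefix $R_1P_i$ with $R_1$ free of $P_i,T_i$ and execution deadlocks exactly before this $P_i$. Blocking type $(P_1,P_2)$ of $\tau$ means $\tau(!)$ has type $P_1$ and $\tau(?)$ has type $P_2$. $\{A,B\}^*$ denotes arbitrary finite strings over $A,B$. -}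

module Defs where

open import Data.List using (List; []; _∷_; _++_; map)
open import Data.List.Membership.Propositional using (_∈_)
open import Data.List.Relation.Binary.Permutation.Propositional using (_↭_)
open import Data.List.Relation.Unary.All using (All)
open import Data.Maybe using (Maybe; just; nothing)
open import Data.Product using (Σ; ∃; _×_; _,_)
open import Data.Empty using (⊥)
open import Relation.Binary.PropositionalEquality using (_≡_)
open import Relation.Nullary using (¬_)
open import Relation.Binary.Construct.Closure.ReflexiveTransitive using (Star)
open import Function.Bundles using (_⇔_)

data SU : Set where
  ✓   : SU
  nil : SU
  !·_ : SU → SU
  ?·_ : SU → SU

-- processes: multisets of subprocesses, represented as lists up to permutation
SProc : Set
SProc = List SU

data _⟶S_ : SProc → SProc → Set where
  sync : ∀ {P Q U₁ U₂} → P ↭ ((!· U₁) ∷ (?· U₂) ∷ Q) → P ⟶S (U₁ ∷ U₂ ∷ Q)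

_⟶S*_ : SProc → SProc → Set
_⟶S*_ = Star _⟶S_

SSuccessful : SProc → Set
SSuccessful P = ✓ ∈ P

SMay : SProc → Set
SMay P = ∃ λ Q → P ⟶S* Q × SSuccessful Q

SMust : SProc → Set
SMust P = ∀ Q → P ⟶S* Q → SMay Q

data Lock : Set where
  l₁ l₂ : Lock

data LockState : Set where
  full empty : LockState          -- ■ and □

Store : Set
Store = LockState × LockState

get : Store → Lock → LockState
get (a , b) l₁ = a
get (a , b) l₂ = b

set : Store → Lock → LockState → Store
set (a , b) l₁ s = (s , b)
set (a , b) l₂ s = (a , s)

data Act : Set where
  P T : Lock → Act

data LU : Set where
  ✓   : LU
  nil : LU
  _∙_ : Act → LU → LU

LProc : Set
LProc = List LU

Config : Set
Config = LProc × Store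

data _⟶L_ : Config → Config → Set where
  put  : ∀ {Q R U i σ} → Q ↭ ((P i ∙ U) ∷ R) → get σ i ≡ empty →
         (Q , σ) ⟶L ((U ∷ R) , set σ i full)
  take : ∀ {Q R U i σ} → Q ↭ ((T i ∙ U) ∷ R) →
         (Q , σ) ⟶L ((U ∷ R) , set σ i empty)

_⟶L*_ : Config → Config → Set
_⟶L*_ = Star _⟶L_

LSuccessful : Config → Set
LSuccessful (Q , σ) = ✓ ∈ Q

LMay : Config → Set
LMay c = ∃ λ d → c ⟶L* d × LSuccessful d

LMust : Config → Set
LMust c = ∀ d → c ⟶L* d → LMay d

-- Compositional translations SYNCSIMPLE → LOCKSIMPLE_{2,IS}
-- determined by the action words τ(!) and τ(?)

record Translation : Set where
  field
    τ! : List Act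
    τ? : List Act

prepend : List Act → LU → LU
prepend []       U = U
prepend (a ∷ as) U = a ∙ prepend as U

trU : Translation → SU → LU
trU τ ✓     = ✓
trU τ nil   = nil
trU τ (!· U) = prepend (Translation.τ! τ) (trU τ U)
trU τ (?· U) = prepend (Translation.τ? τ) (trU τ U)

trP : Translation → SProc → LProc
trP τ = map (trU τ)

Correct : Store → Translation → Set
Correct IS τ = ∀ (Q : SProc) →
  (SMay Q ⇔ LMay (trP τ Q , IS)) × (SMust Q ⇔ LMust (trP τ Q , IS))

-- running a single action sequence alone; nothing = deadlock
run : Store → List Act → Maybe Store
run σ []          = just σ
run σ (P i ∷ as) with get σ i
... | empty = run (set σ i full) as
... | full  = nothing
run σ (T i ∷ as) = run (set σ i empty) as

BlockingType : Store → Lock → List Act → Set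
BlockingType IS i S =
  Σ (List Act) λ R₁ → Σ (List Act) λ rest →
    S ≡ R₁ ++ (P i ∷ rest) ×
    All (λ a → ¬ (a ≡ P i) × ¬ (a ≡ T i)) R₁ ×
    Σ Store (λ σ → run IS R₁ ≡ just σ × get σ i ≡ full)

HasPrefixIn : Act → Act → Act → List Act → Set
HasPrefixIn A B C S =
  Σ (List Act) λ R → Σ (List Act) λ rest →
    S ≡ R ++ (C ∷ rest) × All (λ a → (a ≡ A) Data.Sum.⊎ (a ≡ B)) R
  where import Data.Sum

-- Neither blocking prefix touches the lock it blocks on, so that lock still has
-- its initial value when the word deadlocks: both locks must start full. The same
-- prefixes consist only of actions on the other lock, which gives the shape of the
-- prefixes.
module Submission where

open import Defs
open import Data.Empty using (⊥-elim)
open import Data.List using (List; []; _∷_)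
open import Data.List.Relation.Unary.All as All using (All; []; _∷_)
open import Data.Maybe using (just)
open import Data.Product using (_×_; _,_)
open import Data.Sum using (_⊎_; inj₁; inj₂)
open import Relation.Binary.PropositionalEquality using (_≡_; _≢_; refl; sym; trans; cong₂)
open import Relation.Nullary using (¬_)

other : Lock → Lock
other l₁ = l₂
other l₂ = l₁

Untouched : Lock → Act → Set
Untouched i a = ¬ (a ≡ P i) × ¬ (a ≡ T i)

untouched⇒on-other : ∀ i a → Untouched i a → (a ≡ P (other i)) ⊎ (a ≡ T (other i))
untouched⇒on-other l₁ (P l₂) _       = inj₁ refl
untouched⇒on-other l₂ (P l₁) _       = inj₁ refl
untouched⇒on-other l₁ (T l₂) _       = inj₂ refl
untouched⇒on-other l₂ (T l₁) _       = inj₂ refl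
untouched⇒on-other l₁ (P l₁) (P≢ , _) = ⊥-elim (P≢ refl)
untouched⇒on-other l₂ (P l₂) (P≢ , _) = ⊥-elim (P≢ refl)
untouched⇒on-other l₁ (T l₁) (_ , T≢) = ⊥-elim (T≢ refl)
untouched⇒on-other l₂ (T l₂) (_ , T≢) = ⊥-elim (T≢ refl)

get-set-other : ∀ σ {i j} s → i ≢ j → get (set σ j s) i ≡ get σ i
get-set-other σ {l₁} {l₁} s i≢j = ⊥-elim (i≢j refl)
get-set-other σ {l₁} {l₂} s _   = refl
get-set-other σ {l₂} {l₁} s _   = refl
get-set-other σ {l₂} {l₂} s i≢j = ⊥-elim (i≢j refl)

run-preserves-untouched : ∀ i {σ σ′} R → All (Untouched i) R →
                          run σ R ≡ just σ′ → get σ′ i ≡ get σ i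
run-preserves-untouched i [] [] refl = refl
run-preserves-untouched i {σ} (P j ∷ R) ((P≢ , _) ∷ u) eq with get σ j
... | empty = trans (run-preserves-untouched i R u eq)
                    (get-set-other σ {i} {j} full λ { refl → P≢ refl })
... | full with () ← eq
run-preserves-untouched i {σ} (T j ∷ R) ((_ , T≢) ∷ u) eq =
  trans (run-preserves-untouched i R u eq) (get-set-other σ {i} {j} empty λ { refl → T≢ refl })

blocking-lock-initially-full : ∀ {IS i S} → BlockingType IS i S → get IS i ≡ full
blocking-lock-initially-full {i = i} (R₁ , _ , _ , untouched , σ , ran , blocked) =
  trans (sym (run-preserves-untouched i R₁ untouched ran)) blocked

blocking-prefix : ∀ {IS i S} → BlockingType IS i S →
                  HasPrefixIn (P (other i)) (T (other i)) (P i) S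
blocking-prefix {i = i} (R₁ , rest , S≡ , untouched , _) =
  R₁ , rest , S≡ , All.map (λ {a} → untouched⇒on-other i a) untouched

store-≡ : ∀ σ {a b} → get σ l₁ ≡ a → get σ l₂ ≡ b → σ ≡ (a , b)
store-≡ (a , b) = cong₂ _,_

lemma5p12 : (IS : Store) (τ : Translation) →
    Correct IS τ →
    BlockingType IS l₁ (Translation.τ! τ) →
    BlockingType IS l₂ (Translation.τ? τ) →
    (IS ≡ (full , full)) ×
    HasPrefixIn (P l₂) (T l₂) (P l₁) (Translation.τ! τ) ×
    HasPrefixIn (P l₁) (T l₁) (P l₂) (Translation.τ? τ)
lemma5p12 IS τ _ block! block? =
  store-≡ IS (blocking-lock-initially-full block!) (blocking-lock-initially-full block?) ,
  blocking-prefix block! ,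
  blocking-prefix block?
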